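{- Let $p$ be an odd positive integer and $m\ge 3$. Assume that the cycle $C_m$ has an edge-magic labeling $f$. Then: (i) if $m$ is odd or $m\ge p$, the cycle $C_{pm}$ has an edge-magic labeling with valence $p\,\mathrm{val}(f)-3(p-1)/2$; (ii) $C_{pm}$ has an edge-magic labeling with valence $3(p-1)m+\mathrm{val}(f)$.
   Context: An edge-magic labeling of a graph $G$ with $p'$ vertices and $q'$ edges is a bijection $f:V(G)\cup E(G)\to\{1,\dots,p'+q'\}$ such that $f(x)+f(xy)+f(y)$ equals a constant $\mathrm{val}(f)$ (the valence) for every edge $xy$. $C_m$ denotes the cycle of length $m$. -}

module Defs where

open import Data.Nat as ℕ using (ℕ; _+_; _*_; _≤_; NonZero)
open import Data.Nat.DivMod using (_%_)
open import Data.Fin using (Fin; toℕ; fromℕ<; zero; suc)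
open import Data.Nat using (_<?_)
open import Relation.Nullary using (yes; no)
open import Data.Fin.Properties using ()
open import Data.Nat.DivMod using (m%n<n)
open import Data.Sum using (_⊎_; inj₁; inj₂)
open import Data.Product using (Σ; _×_; _,_)
open import Function.Bundles using (Bijection)
open import Relation.Binary.PropositionalEquality using (_≡_; setoid)

-- The cycle C_m (m ≥ 1): vertices Fin m, edges Fin m, where edge i joins
-- vertex i and vertex (i+1) mod m.
next : (m : ℕ) → Fin m → Fin m
next (ℕ.suc n) i with toℕ i <? n
... | yes i<n = suc (fromℕ< i<n)
... | no _ = zero

-- Elements of C_m: inj₁ i = vertex i, inj₂ i = edge i.
Element : ℕ → Set
Element m = Fin m ⊎ Fin m

-- A labeling is a bijection from V ∪ E onto {1,…,2m}; we represent
-- {1,…,2m} by Fin (m + m), the label of x being toℕ (L x) + 1.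
Labeling : ℕ → Set
Labeling m = Bijection (setoid (Element m)) (setoid (Fin (m + m)))

label : {m : ℕ} → Labeling m → Element m → ℕ
label f x = ℕ.suc (toℕ (Bijection.to f x))

IsEdgeMagicWithValence : (m : ℕ) → Labeling m → ℕ → Set
IsEdgeMagicWithValence m f k =
  (i : Fin m) → label f (inj₁ i) + label f (inj₂ i) + label f (inj₁ (next m i)) ≡ k

HasEdgeMagicValence : (m : ℕ) → ℕ → Set
HasEdgeMagicValence m k = Σ (Labeling m) λ f → IsEdgeMagicWithValence m f k

-- Write p = 2s+1. The rows j ↦ j/2, j ↦ (j+1)/2 and j ↦ 2s − (j+1) (indices and halving
-- taken modulo p) form a Kotzig array: each row is a permutation of 0,…,p−1 and every column
-- sums to 3s; moreover the middle row is the top row shifted by one column. Cut C_pm into p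
-- consecutive copies of C_m and give the element x of copy j a label combining f(x) with an
-- entry of column j: vertices alternate between the top and bottom rows and edges take the
-- middle row, except the last edge of a copy, which takes the remaining row because its far
-- endpoint is the first vertex of copy j+1, whose top entry in column j+1 is the middle entry
-- of column j. Thus along every edge the array entries exhaust one column, so encoding the pair
-- (f-label ℓ, entry r) bijectively as pℓ + r, or as ℓ + 2mr, makes all edge sums equal to
-- p(val f − 3) + 3s + 3, resp. (val f − 3) + 2m·3s + 3: these are the valences of (i) and (ii).

module Submission where

open import Defs
open import Data.Nat using (ℕ; zero; suc; _+_; _*_; _∸_; _≤_; _<_; _<?_; _≤?_; s≤s; z≤n; parity)
open import Data.Nat.Properties
open import Data.Nat.DivMod using (_%_; _/_; m≡m%n+[m/n]*n; m*n/n≡m)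
open import Data.Nat.Tactic.RingSolver using (solve-∀)
open import Data.Fin using (Fin; zero; suc; toℕ; fromℕ; fromℕ<; inject₁; combine; opposite)
open import Data.Fin.Properties
  using ( toℕ-injective; toℕ<n; toℕ-fromℕ; toℕ-fromℕ<; toℕ-inject₁; toℕ-combine; toℕ-cast
        ; opposite-prop; *↔×; combine-surjective )
open import Data.Fin.Permutation using (Permutation′; permutation; _⟨$⟩ʳ_; _∘ₚ_; reverse; cast-id)
open import Data.Parity.Base using (Parity; 0ℙ; 1ℙ; _⁻¹)
open import Data.Parity.Properties using (suc-homo-⁻¹; ⁻¹-selfInverse)
open import Data.Sum using (_⊎_; inj₁; inj₂)
open import Data.Sum.Function.Propositional using (_⊎-↔_)
open import Data.Product using (_×_; _,_; ∃)
open import Data.Product.Algebra using (×-comm; ×-distribˡ-⊎)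
open import Data.Product.Function.Dependent.Propositional using (Σ-↔)
open import Function using (_∘′_)
open import Function.Bundles using (_↔_; Inverse; Bijection)
open import Function.Construct.Composition using (_↔-∘_)
open import Function.Construct.Symmetry using (↔-sym)
open import Function.Properties.Bijection using (⤖⇒↔)
open import Function.Properties.Inverse using (↔⇒⤖)
open import Level using (0ℓ)
open import Relation.Nullary using (yes; no; contradiction)
open import Relation.Binary.PropositionalEquality
open ≡-Reasoning

toℕ-next-< : ∀ {n} (i : Fin n) → suc (toℕ i) < n → toℕ (next n i) ≡ suc (toℕ i)
toℕ-next-< {suc n} i 1+i<n with toℕ i <? n
... | yes i<n = cong suc (toℕ-fromℕ< i<n)
... | no  i≮n = contradiction (≤-pred 1+i<n) i≮n

toℕ-next-last : ∀ {n} (i : Fin n) → suc (toℕ i) ≡ n → toℕ (next n i) ≡ 0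
toℕ-next-last {suc n} i 1+i≡n with toℕ i <? n
... | yes i<n = contradiction (suc-injective 1+i≡n) (<⇒≢ i<n)
... | no  _   = refl

next-≡ : ∀ {n} (i j : Fin n) → suc (toℕ i) ≡ toℕ j → next n i ≡ j
next-≡ {n} i j 1+i≡j = toℕ-injective (trans (toℕ-next-< i 1+i<n) 1+i≡j)
  where 1+i<n = subst (_< n) (sym 1+i≡j) (toℕ<n j)

prev : ∀ {n} → Fin n → Fin n
prev {suc n} zero    = fromℕ n
prev {suc n} (suc i) = inject₁ i

next-prev : ∀ {n} (i : Fin n) → next n (prev i) ≡ i
next-prev {suc n} zero    = toℕ-injective (toℕ-next-last (fromℕ n) (cong suc (toℕ-fromℕ n)))
next-prev {suc n} (suc i) = next-≡ (inject₁ i) (suc i) (cong suc (toℕ-inject₁ i))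

prev-next : ∀ {n} (i : Fin n) → prev (next n i) ≡ i
prev-next {suc n} i with toℕ i <? n
... | yes i<n = toℕ-injective (trans (toℕ-inject₁ _) (toℕ-fromℕ< i<n))
... | no  i≮n = toℕ-injective (trans (toℕ-fromℕ n) (sym (≤∧≮⇒≡ (≤-pred (toℕ<n i)) i≮n)))

next-↔ : ∀ n → Permutation′ n
next-↔ n = permutation (next n) prev next-prev prev-next

module _ {p m : ℕ} (j : Fin p) (i : Fin m) where

  suc-toℕ-combine : suc (toℕ (combine j i)) ≡ m * toℕ j + suc (toℕ i)
  suc-toℕ-combine = trans (cong suc (toℕ-combine j i)) (sym (+-suc (m * toℕ j) (toℕ i)))

  next-combine-< : suc (toℕ i) < m → next (p * m) (combine j i) ≡ combine j (next m i)
  next-combine-< 1+i<m = next-≡ _ _ (begin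
    suc (toℕ (combine j i))     ≡⟨ suc-toℕ-combine ⟩
    m * toℕ j + suc (toℕ i)     ≡⟨ cong (m * toℕ j +_) (toℕ-next-< i 1+i<m) ⟨
    m * toℕ j + toℕ (next m i)  ≡⟨ toℕ-combine j (next m i) ⟨
    toℕ (combine j (next m i))  ∎)

  suc-toℕ-combine-last : suc (toℕ i) ≡ m → suc (toℕ (combine j i)) ≡ m * suc (toℕ j)
  suc-toℕ-combine-last 1+i≡m = begin
    suc (toℕ (combine j i))  ≡⟨ suc-toℕ-combine ⟩
    m * toℕ j + suc (toℕ i)  ≡⟨ cong (m * toℕ j +_) 1+i≡m ⟩
    m * toℕ j + m            ≡⟨ +-comm (m * toℕ j) m ⟩
    m + m * toℕ j            ≡⟨ *-suc m (toℕ j) ⟨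
    m * suc (toℕ j)          ∎

  next-combine-last : suc (toℕ i) ≡ m → next (p * m) (combine j i) ≡ combine (next p j) (next m i)
  next-combine-last 1+i≡m with m≤n⇒m<n∨m≡n (toℕ<n j)
  ... | inj₁ 1+j<p = next-≡ _ _ (begin
    suc (toℕ (combine j i))              ≡⟨ suc-toℕ-combine-last 1+i≡m ⟩
    m * suc (toℕ j)                      ≡⟨ +-identityʳ _ ⟨
    m * suc (toℕ j) + 0                  ≡⟨ cong₂ (λ x y → m * x + y) (toℕ-next-< j 1+j<p) (toℕ-next-last i 1+i≡m) ⟨
    m * toℕ (next p j) + toℕ (next m i)  ≡⟨ toℕ-combine (next p j) (next m i) ⟨
    toℕ (combine (next p j) (next m i))  ∎)
  ... | inj₂ 1+j≡p = toℕ-injective (begin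
    toℕ (next (p * m) (combine j i))     ≡⟨ toℕ-next-last (combine j i) wraps ⟩
    0                                    ≡⟨ trans (+-identityʳ (m * 0)) (*-zeroʳ m) ⟨
    m * 0 + 0                            ≡⟨ cong₂ (λ x y → m * x + y) (toℕ-next-last j 1+j≡p) (toℕ-next-last i 1+i≡m) ⟨
    m * toℕ (next p j) + toℕ (next m i)  ≡⟨ toℕ-combine (next p j) (next m i) ⟨
    toℕ (combine (next p j) (next m i))  ∎)
    where
    wraps : suc (toℕ (combine j i)) ≡ p * m
    wraps = trans (suc-toℕ-combine-last 1+i≡m) (trans (cong (m *_) 1+j≡p) (*-comm m p))

module _ {n : ℕ} (f g : ℕ → ℕ)
         (f-< : ∀ {x} → x < n → f x < n) (g-< : ∀ {x} → x < n → g x < n)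
         (g∘f : ∀ {x} → x < n → g (f x) ≡ x) (f∘g : ∀ {x} → x < n → f (g x) ≡ x) where

  permutationFromℕ : Permutation′ n
  permutationFromℕ = permutation
    (λ i → fromℕ< (f-< (toℕ<n i)))
    (λ i → fromℕ< (g-< (toℕ<n i)))
    (λ i → toℕ-injective (trans (toℕ-fromℕ< _) (trans (cong f (toℕ-fromℕ< _)) (f∘g (toℕ<n i)))))
    (λ i → toℕ-injective (trans (toℕ-fromℕ< _) (trans (cong g (toℕ-fromℕ< _)) (g∘f (toℕ<n i)))))

  toℕ-permutationFromℕ : ∀ i → toℕ (permutationFromℕ ⟨$⟩ʳ i) ≡ f (toℕ i)
  toℕ-permutationFromℕ i = toℕ-fromℕ< _

data EvenOdd : ℕ → Set where
  even : ∀ k → EvenOdd (k + k)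
  odd  : ∀ k → EvenOdd (suc (k + k))

evenOdd : ∀ n → EvenOdd n
evenOdd zero          = even 0
evenOdd (suc zero)    = odd 0
evenOdd (suc (suc n)) with evenOdd n
... | even k = subst EvenOdd (cong suc (+-suc k k)) (even (suc k))
... | odd  k = subst EvenOdd (cong (suc ∘′ suc) (+-suc k k)) (odd (suc k))

double-cancel-< : ∀ {k l} → k + k < l + l → k < l
double-cancel-< k+k<l+l = ≰⇒> (λ l≤k → <⇒≱ k+k<l+l (+-mono-≤ l≤k l≤k))

double-cancel-≤ : ∀ {k l} → k + k ≤ l + l → k ≤ l
double-cancel-≤ k+k≤l+l = ≮⇒≥ (λ l<k → <⇒≱ (+-mono-< l<k l<k) k+k≤l+l)

module _ (s : ℕ) where

  -- Halving and doubling in ℤ/(2s+1), on representatives 0,…,2s.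
  halveMod : ℕ → ℕ
  halveMod zero          = zero
  halveMod (suc zero)    = suc s
  halveMod (suc (suc j)) = suc (halveMod j)

  doubleMod : ℕ → ℕ
  doubleMod u with u ≤? s
  ... | yes _ = u + u
  ... | no  _ = suc ((u ∸ suc s) + (u ∸ suc s))

  halveMod-even : ∀ k → halveMod (k + k) ≡ k
  halveMod-even zero    = refl
  halveMod-even (suc k) rewrite +-suc k k = cong suc (halveMod-even k)

  halveMod-odd : ∀ k → halveMod (suc (k + k)) ≡ suc (s + k)
  halveMod-odd zero    = cong suc (sym (+-identityʳ s))
  halveMod-odd (suc k) rewrite +-suc k k | +-suc s k = cong suc (halveMod-odd k)

  halveMod-consecutive : ∀ j → halveMod j + halveMod (suc j) ≡ suc (s + j)
  halveMod-consecutive zero          = cong suc (sym (+-identityʳ s))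
  halveMod-consecutive (suc zero)    = refl
  halveMod-consecutive (suc (suc j)) = begin
    suc (halveMod j) + suc (halveMod (suc j))  ≡⟨ cong suc (+-suc (halveMod j) (halveMod (suc j))) ⟩
    suc (suc (halveMod j + halveMod (suc j)))  ≡⟨ cong (suc ∘′ suc) (halveMod-consecutive j) ⟩
    suc (suc (suc (s + j)))                    ≡⟨ cong suc (trans (+-suc s (suc j)) (cong suc (+-suc s j))) ⟨
    suc (s + suc (suc j))                      ∎

  halveMod-< : ∀ {j} → j < suc (s + s) → halveMod j < suc (s + s)
  halveMod-< {j} j<p with evenOdd j
  ... | even k rewrite halveMod-even k = ≤-<-trans (m≤m+n k k) j<p
  ... | odd  k rewrite halveMod-odd k  = s≤s (+-monoʳ-< s (double-cancel-< (≤-pred j<p)))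

  doubleMod-< : ∀ {u} → u < suc (s + s) → doubleMod u < suc (s + s)
  doubleMod-< {u} u<p with u ≤? s
  ... | yes u≤s = s≤s (+-mono-≤ u≤s u≤s)
  ... | no  u≰s = s≤s (+-mono-< w<s w<s)
    where
    w<s : u ∸ suc s < s
    w<s = +-cancelˡ-< (suc s) (u ∸ suc s) s
            (subst (_< suc s + s) (sym (m+[n∸m]≡n (≰⇒> u≰s))) u<p)

  doubleMod-halveMod : ∀ {j} → j < suc (s + s) → doubleMod (halveMod j) ≡ j
  doubleMod-halveMod {j} j<p with evenOdd j
  ... | even k rewrite halveMod-even k with k ≤? s
  ...   | yes _   = refl
  ...   | no  k≰s = contradiction (double-cancel-≤ (≤-pred j<p)) k≰s
  doubleMod-halveMod {j} j<p | odd k rewrite halveMod-odd k with suc (s + k) ≤? s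
  ...   | yes s+k<s = contradiction s+k<s (m+n≮m s k)
  ...   | no  _     = cong (λ w → suc (w + w)) (m+n∸m≡n s k)

  halveMod-doubleMod : ∀ {u} → u < suc (s + s) → halveMod (doubleMod u) ≡ u
  halveMod-doubleMod {u} _ with u ≤? s
  ... | yes _   = halveMod-even u
  ... | no  u≰s = trans (halveMod-odd (u ∸ suc s)) (m+[n∸m]≡n (≰⇒> u≰s))

  halveMod-column : ∀ j → suc j ≤ s + s → halveMod j + halveMod (suc j) + (s + s ∸ suc j) ≡ s + s + s
  halveMod-column j 1+j≤2s = begin
    halveMod j + halveMod (suc j) + (s + s ∸ suc j)  ≡⟨ cong (_+ (s + s ∸ suc j)) (halveMod-consecutive j) ⟩
    suc (s + j) + (s + s ∸ suc j)                    ≡⟨ cong (_+ (s + s ∸ suc j)) (+-suc s j) ⟨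
    s + suc j + (s + s ∸ suc j)                      ≡⟨ +-assoc s (suc j) _ ⟩
    s + (suc j + (s + s ∸ suc j))                    ≡⟨ cong (s +_) (m+[n∸m]≡n 1+j≤2s) ⟩
    s + (s + s)                                      ≡⟨ +-assoc s s s ⟨
    s + s + s                                        ∎

  halving : Permutation′ (suc (s + s))
  halving = permutationFromℕ halveMod doubleMod halveMod-< doubleMod-< doubleMod-halveMod halveMod-doubleMod

  toℕ-halving : ∀ j → toℕ (halving ⟨$⟩ʳ j) ≡ halveMod (toℕ j)
  toℕ-halving = toℕ-permutationFromℕ halveMod doubleMod halveMod-< doubleMod-< doubleMod-halveMod halveMod-doubleMod

-- A Kotzig array (three rows, each a permutation of 0,…,p−1, with constant column sums S)
-- whose middle row is its top row shifted by one column; only top and bottom are stored.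
record ShiftedKotzigArray (p S : ℕ) : Set where
  field
    top bottom : Permutation′ p
    column-sum : ∀ j → toℕ (top ⟨$⟩ʳ j) + toℕ (top ⟨$⟩ʳ next p j) + toℕ (bottom ⟨$⟩ʳ j) ≡ S

shiftedKotzigArray : ∀ s → ShiftedKotzigArray (suc (s + s)) (s + s + s)
shiftedKotzigArray s = record
  { top        = halving s
  ; bottom     = next-↔ _ ∘ₚ reverse
  ; column-sum = column-sum
  }
  where
  column-sum : ∀ j → toℕ (halving s ⟨$⟩ʳ j) + toℕ (halving s ⟨$⟩ʳ next _ j) + toℕ (opposite (next _ j)) ≡ s + s + s
  column-sum j rewrite toℕ-halving s j | toℕ-halving s (next _ j) | opposite-prop (next _ j)
    with m≤n⇒m<n∨m≡n (toℕ<n j)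
  ... | inj₁ 1+j<p rewrite toℕ-next-< j 1+j<p = halveMod-column s (toℕ j) (≤-pred 1+j<p)
  ... | inj₂ 1+j≡p rewrite toℕ-next-last j 1+j≡p | suc-injective 1+j≡p | halveMod-even s s =
    trans (cong (_+ (s + s)) (+-identityʳ s)) (sym (+-assoc s s s))

copies-↔ : ∀ p m → (Element m × Fin p) ↔ Element (p * m)
copies-↔ p m = (↔-sym *↔× ⊎-↔ ↔-sym *↔×) ↔-∘ (×-distribˡ-⊎ 0ℓ _ _ _ ↔-∘ ×-comm _ _)

-- Vertex or edge i of copy j is vertex or edge m·j + i of C_pm (combine j i).
copy : ∀ {p m} → Fin p → Element m → Element (p * m)
copy {p} {m} j x = Inverse.to (copies-↔ p m) (x , j)

parity-suc : ∀ n → parity (suc n) ≡ parity n ⁻¹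
parity-suc n = sym (⁻¹-selfInverse (suc-homo-⁻¹ n))

data Row : Set where
  top middle bottom : Row

vertexRow : Parity → Row
vertexRow 0ℙ = top
vertexRow 1ℙ = bottom

rowOf : ∀ {m} → Element m → Row
rowOf (inj₁ i) = vertexRow (parity (toℕ i))
rowOf {m} (inj₂ i) with suc (toℕ i) <? m
... | yes _ = middle
... | no  _ = vertexRow (parity (toℕ i) ⁻¹)

module _ {m : ℕ} (i : Fin m) where

  rowOf-edge-< : suc (toℕ i) < m → rowOf (inj₂ i) ≡ middle
  rowOf-edge-< 1+i<m with suc (toℕ i) <? m
  ... | yes _    = refl
  ... | no  1+i≮m = contradiction 1+i<m 1+i≮m

  rowOf-edge-last : suc (toℕ i) ≡ m → rowOf (inj₂ i) ≡ vertexRow (parity (toℕ i) ⁻¹)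
  rowOf-edge-last 1+i≡m with suc (toℕ i) <? m
  ... | yes 1+i<m = contradiction 1+i≡m (<⇒≢ 1+i<m)
  ... | no  _     = refl

  rowOf-next-< : suc (toℕ i) < m → rowOf (inj₁ (next m i)) ≡ vertexRow (parity (toℕ i) ⁻¹)
  rowOf-next-< 1+i<m = cong vertexRow (trans (cong parity (toℕ-next-< i 1+i<m)) (parity-suc (toℕ i)))

  rowOf-next-last : suc (toℕ i) ≡ m → rowOf (inj₁ (next m i)) ≡ top
  rowOf-next-last 1+i≡m = cong (vertexRow ∘′ parity) (toℕ-next-last i 1+i≡m)

module _ {p S : ℕ} (A : ShiftedKotzigArray p S) where
  private module A = ShiftedKotzigArray A

  row : Row → Permutation′ p
  row top    = A.top
  row middle = next-↔ p ∘ₚ A.top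
  row bottom = A.bottom

  entry : Row → Fin p → ℕ
  entry r j = toℕ (row r ⟨$⟩ʳ j)

  column-sum-inner : ∀ q j → entry (vertexRow q) j + entry middle j + entry (vertexRow (q ⁻¹)) j ≡ S
  column-sum-inner 0ℙ j = A.column-sum j
  column-sum-inner 1ℙ j = trans (swap₁₃ (entry bottom j) (entry middle j) (entry top j)) (A.column-sum j)
    where
    swap₁₃ : ∀ x y z → x + y + z ≡ z + y + x
    swap₁₃ = solve-∀

  column-sum-last : ∀ q j → entry (vertexRow q) j + entry (vertexRow (q ⁻¹)) j + entry top (next p j) ≡ S
  column-sum-last 0ℙ j = trans (swap₂₃ (entry top j) (entry bottom j) (entry middle j)) (A.column-sum j)
    where
    swap₂₃ : ∀ x y z → x + y + z ≡ x + z + y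
    swap₂₃ = solve-∀
  column-sum-last 1ℙ j = trans (rotate (entry bottom j) (entry top j) (entry middle j)) (A.column-sum j)
    where
    rotate : ∀ x y z → x + y + z ≡ y + z + x
    rotate = solve-∀

  module _ {m : ℕ} (i : Fin m) (j : Fin p) where

    edge-column-< : suc (toℕ i) < m →
      entry (rowOf (inj₁ i)) j + entry (rowOf (inj₂ i)) j + entry (rowOf (inj₁ (next m i))) j ≡ S
    edge-column-< 1+i<m rewrite rowOf-edge-< i 1+i<m | rowOf-next-< i 1+i<m =
      column-sum-inner (parity (toℕ i)) j

    edge-column-last : suc (toℕ i) ≡ m →
      entry (rowOf (inj₁ i)) j + entry (rowOf (inj₂ i)) j + entry (rowOf (inj₁ (next m i))) (next p j) ≡ S
    edge-column-last 1+i≡m rewrite rowOf-edge-last i 1+i≡m | rowOf-next-last i 1+i≡m =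
      column-sum-last (parity (toℕ i)) j

sum-of-sucs : ∀ {x y z v} → suc x + suc y + suc z ≡ v → x + y + z ≡ v ∸ 3
sum-of-sucs {x} {y} {z} refl = sym (trans (cong (_∸ 3) (shift x y z)) (m+n∸n≡m (x + y + z) 3))
  where
  shift : ∀ x y z → suc x + suc y + suc z ≡ x + y + z + 3
  shift = solve-∀

sum-of-encodings : ∀ a b x₁ x₂ x₃ y₁ y₂ y₃ →
  suc (a * x₁ + b * y₁) + suc (a * x₂ + b * y₂) + suc (a * x₃ + b * y₃) ≡ a * (x₁ + x₂ + x₃) + b * (y₁ + y₂ + y₃) + 3
sum-of-encodings = solve-∀

module Product {m p S a b : ℕ} (f : Labeling m) (A : ShiftedKotzigArray p S)
               (encode : (Fin (m + m) × Fin p) ↔ Fin (p * m + p * m))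
               (toℕ-encode : ∀ ℓ r → toℕ (Inverse.to encode (ℓ , r)) ≡ a * toℕ ℓ + b * toℕ r) where

  relabel : (Element m × Fin p) ↔ (Fin (m + m) × Fin p)
  relabel = Σ-↔ (⤖⇒↔ f) (λ {x} → row A (rowOf x))

  labeling : Labeling (p * m)
  labeling = ↔⇒⤖ (encode ↔-∘ (relabel ↔-∘ ↔-sym (copies-↔ p m)))

  label-copy : ∀ j x → label labeling (copy j x) ≡ suc (a * toℕ (Bijection.to f x) + b * entry A (rowOf x) j)
  label-copy j x = cong suc (begin
    toℕ (Bijection.to labeling (copy j x))
      ≡⟨ cong (λ y → toℕ (Inverse.to encode (Inverse.to relabel y))) (Inverse.strictlyInverseʳ (copies-↔ p m) (x , j)) ⟩
    toℕ (Inverse.to encode (Bijection.to f x , row A (rowOf x) ⟨$⟩ʳ j))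
      ≡⟨ toℕ-encode _ _ ⟩
    a * toℕ (Bijection.to f x) + b * entry A (rowOf x) j  ∎)

  edge-sum-copies : ∀ {v} → IsEdgeMagicWithValence m f v → ∀ j j′ i →
    next (p * m) (combine j i) ≡ combine j′ (next m i) →
    entry A (rowOf (inj₁ i)) j + entry A (rowOf (inj₂ i)) j + entry A (rowOf (inj₁ (next m i))) j′ ≡ S →
    label labeling (inj₁ (combine j i)) + label labeling (inj₂ (combine j i))
      + label labeling (inj₁ (next (p * m) (combine j i))) ≡ a * (v ∸ 3) + b * S + 3
  edge-sum-copies {v} magic j j′ i next≡ column = begin
    label labeling (copy j (inj₁ i)) + label labeling (copy j (inj₂ i))
      + label labeling (inj₁ (next (p * m) (combine j i)))
      ≡⟨ cong (λ t → label labeling (copy j (inj₁ i)) + label labeling (copy j (inj₂ i)) + label labeling (inj₁ t)) next≡ ⟩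
    label labeling (copy j (inj₁ i)) + label labeling (copy j (inj₂ i))
      + label labeling (copy j′ (inj₁ (next m i)))
      ≡⟨ cong₂ _+_ (cong₂ _+_ (label-copy j (inj₁ i)) (label-copy j (inj₂ i))) (label-copy j′ (inj₁ (next m i))) ⟩
    _ ≡⟨ sum-of-encodings a b _ _ _ _ _ _ ⟩
    a * _ + b * _ + 3
      ≡⟨ cong₂ (λ x y → a * x + b * y + 3) (sum-of-sucs (magic i)) column ⟩
    a * (v ∸ 3) + b * S + 3  ∎

  edgeMagic : ∀ {v} → IsEdgeMagicWithValence m f v → IsEdgeMagicWithValence (p * m) labeling (a * (v ∸ 3) + b * S + 3)
  edgeMagic magic t with combine-surjective {p} {m} t
  ... | j , i , refl with m≤n⇒m<n∨m≡n (toℕ<n i)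
  ...   | inj₁ 1+i<m = edge-sum-copies magic j j i (next-combine-< j i 1+i<m) (edge-column-< A i j 1+i<m)
  ...   | inj₂ 1+i≡m = edge-sum-copies magic j (next p j) i (next-combine-last j i 1+i≡m) (edge-column-last A i j 1+i≡m)

module _ (p m : ℕ) where

  arrayMajor-↔ : (Fin (m + m) × Fin p) ↔ Fin (p * m + p * m)
  arrayMajor-↔ = cast-id (*-distribˡ-+ p m m) ↔-∘ (↔-sym *↔× ↔-∘ ×-comm _ _)

  toℕ-arrayMajor : ∀ ℓ r → toℕ (Inverse.to arrayMajor-↔ (ℓ , r)) ≡ 1 * toℕ ℓ + (m + m) * toℕ r
  toℕ-arrayMajor ℓ r = begin
    toℕ (Inverse.to arrayMajor-↔ (ℓ , r))  ≡⟨ toℕ-cast _ (combine r ℓ) ⟩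
    toℕ (combine r ℓ)                      ≡⟨ toℕ-combine r ℓ ⟩
    (m + m) * toℕ r + toℕ ℓ                ≡⟨ +-comm _ (toℕ ℓ) ⟩
    toℕ ℓ + (m + m) * toℕ r                ≡⟨ cong (_+ (m + m) * toℕ r) (*-identityˡ (toℕ ℓ)) ⟨
    1 * toℕ ℓ + (m + m) * toℕ r            ∎

  labelMajor-↔ : (Fin (m + m) × Fin p) ↔ Fin (p * m + p * m)
  labelMajor-↔ = cast-id (trans (*-comm (m + m) p) (*-distribˡ-+ p m m)) ↔-∘ ↔-sym *↔×

  toℕ-labelMajor : ∀ ℓ r → toℕ (Inverse.to labelMajor-↔ (ℓ , r)) ≡ p * toℕ ℓ + 1 * toℕ r
  toℕ-labelMajor ℓ r = begin
    toℕ (Inverse.to labelMajor-↔ (ℓ , r))  ≡⟨ toℕ-cast _ (combine ℓ r) ⟩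
    toℕ (combine ℓ r)                      ≡⟨ toℕ-combine ℓ r ⟩
    p * toℕ ℓ + toℕ r                      ≡⟨ cong (p * toℕ ℓ +_) (*-identityˡ (toℕ r)) ⟨
    p * toℕ ℓ + 1 * toℕ r                  ∎

odd⇒≡1+[s+s] : ∀ {p} → p % 2 ≡ 1 → ∃ λ s → p ≡ suc (s + s)
odd⇒≡1+[s+s] {p} p%2≡1 = p / 2 , (begin
  p                  ≡⟨ m≡m%n+[m/n]*n p 2 ⟩
  p % 2 + p / 2 * 2  ≡⟨ cong (_+ p / 2 * 2) p%2≡1 ⟩
  1 + p / 2 * 2      ≡⟨ cong suc (*-comm (p / 2) 2) ⟩
  suc (2 * (p / 2))  ≡⟨ cong (λ k → suc (p / 2 + k)) (+-identityʳ (p / 2)) ⟩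
  suc (p / 2 + p / 2) ∎)

[s+s]/2≡s : ∀ s → (s + s) / 2 ≡ s
[s+s]/2≡s s = trans (cong (_/ 2) (trans (cong (s +_) (sym (+-identityʳ s))) (*-comm 2 s))) (m*n/n≡m s 2)

edgeMagic⇒3≤valence : ∀ {m f v} → 0 < m → IsEdgeMagicWithValence m f v → 3 ≤ v
edgeMagic⇒3≤valence {suc _} _ magic = subst (3 ≤_) (magic zero) (+-mono-≤ (+-mono-≤ (s≤s z≤n) (s≤s z≤n)) (s≤s z≤n))

valence-labelMajor : ∀ s w → suc (s + s) * w + 1 * (s + s + s) + 3 ≡ suc (s + s) * (3 + w) ∸ 3 * ((s + s) / 2)
valence-labelMajor s w = begin
  suc (s + s) * w + 1 * (s + s + s) + 3                            ≡⟨ m+n∸n≡m _ (3 * s) ⟨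
  suc (s + s) * w + 1 * (s + s + s) + 3 + 3 * s ∸ 3 * s            ≡⟨ cong (_∸ 3 * s) (expand s w) ⟩
  suc (s + s) * (3 + w) ∸ 3 * s                                    ≡⟨ cong (λ k → suc (s + s) * (3 + w) ∸ 3 * k) ([s+s]/2≡s s) ⟨
  suc (s + s) * (3 + w) ∸ 3 * ((s + s) / 2)                        ∎
  where
  expand : ∀ s w → suc (s + s) * w + 1 * (s + s + s) + 3 + 3 * s ≡ suc (s + s) * (3 + w)
  expand = solve-∀

valence-arrayMajor : ∀ s m w → 1 * w + (m + m) * (s + s + s) + 3 ≡ 3 * (s + s) * m + (3 + w)
valence-arrayMajor = solve-∀

proposition4p4 : (p m : ℕ) → p % 2 ≡ 1 → 3 ≤ m →
    (f : Labeling m) → (v : ℕ) → IsEdgeMagicWithValence m f v →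
    (((m % 2 ≡ 1) ⊎ (p ≤ m)) → HasEdgeMagicValence (p * m) (p * v ∸ 3 * ((p ∸ 1) / 2)))
    × HasEdgeMagicValence (p * m) (3 * (p ∸ 1) * m + v)
proposition4p4 p m p-odd 3≤m f v magic with odd⇒≡1+[s+s] {p} p-odd
... | s , refl =
  -- The construction for (i) works for every m.
  (λ _ → LabelMajor.labeling , subst (IsEdgeMagicWithValence (p * m) LabelMajor.labeling) valence-i (LabelMajor.edgeMagic magic))
  , ArrayMajor.labeling , subst (IsEdgeMagicWithValence (p * m) ArrayMajor.labeling) valence-ii (ArrayMajor.edgeMagic magic)
  where
  array : ShiftedKotzigArray p (s + s + s)
  array = shiftedKotzigArray s

  module LabelMajor = Product {a = p} {b = 1} f array (labelMajor-↔ p m) (toℕ-labelMajor p m)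
  module ArrayMajor = Product {a = 1} {b = m + m} f array (arrayMajor-↔ p m) (toℕ-arrayMajor p m)

  v≡3+w : 3 + (v ∸ 3) ≡ v
  v≡3+w = m+[n∸m]≡n (edgeMagic⇒3≤valence {f = f} (≤-trans (s≤s z≤n) 3≤m) magic)

  valence-i : p * (v ∸ 3) + 1 * (s + s + s) + 3 ≡ p * v ∸ 3 * ((p ∸ 1) / 2)
  valence-i = trans (valence-labelMajor s (v ∸ 3)) (cong (λ u → p * u ∸ 3 * ((p ∸ 1) / 2)) v≡3+w)

  valence-ii : 1 * (v ∸ 3) + (m + m) * (s + s + s) + 3 ≡ 3 * (p ∸ 1) * m + v
  valence-ii = trans (valence-arrayMajor s m (v ∸ 3)) (cong (3 * (p ∸ 1) * m +_) v≡3+w)
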